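{- Let $\mathcal{O}$ be an annotated $\mathcal{ELH}^r$ ontology in normal form, $S,R\in N_R$, $m\in N_M$, and $a_0,b_0$ individual names not occurring in $\mathcal{O}$. Then $\mathcal{O}\models(S\sqsubseteq R,m)$ iff $\mathcal{O}\cup\{(S(a_0,b_0),1)\}\models(R(a_0,b_0),m)$.
   Context: Fix pairwise disjoint countably infinite sets $N_C$, $N_R$, $N_I$, $N_V$ (concept, role, individual names, provenance variables). Monomials: finite products of variables (empty product $1$), $N_M$ their set, computed in the Trio semiring ($\times$ commutative, associative, idempotent), so $m\approx n$ iff they contain the same variables. $\mathcal{ELH}^r$ concepts $C::=A\mid\exists R.C\mid C\sqcap C\mid\top$; axioms: GCIs $C\sqsubseteq D$ with $D::=A\mid\exists R$, role inclusions $R\sqsubseteq S$, range restrictions ${\sf ran}(R)\sqsubseteq A$, assertions $A(a)$, $R(a,b)$. Annotated ontology: finite set of $(\alpha,v)$, $v\in N_V\cup\{1\}$; normal form: every GCI is $A\sqsubseteq B$, $A\sqcap A'\sqsubseteq B$, $A\sqsubseteq\exists R$ or $\exists R.A\sqsubseteq B$, $A,A'\in N_C\cup\{\top\}$, $B\in N_C$. Annotated interpretation $\mathcal{I}$: domain $\Delta^\mathcal{I}$, disjoint monomial domain $\Delta^\mathcal{I}_m$, $a^\mathcal{I}\in\Delta^\mathcal{I}$, $A^\mathcal{I}\subseteq\Delta^\mathcal{I}\times\Delta^\mathcal{I}_m$, $R^\mathcal{I}\subseteq\Delta^\mathcal{I}\times\Delta^\mathcal{I}\times\Delta^\mathcal{I}_m$,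 $m^\mathcal{I}\in\Delta^\mathcal{I}_m$ with $m^\mathcal{I}=n^\mathcal{I}$ iff $m\approx n$; $\top^\mathcal{I}=\Delta^\mathcal{I}\times\{1^\mathcal{I}\}$, $(\exists R)^\mathcal{I}=\{(d,\mu)\mid\exists e\,(d,e,\mu)\in R^\mathcal{I}\}$, $({\sf ran}(R))^\mathcal{I}=\{(e,\mu)\mid\exists d\,(d,e,\mu)\in R^\mathcal{I}\}$, $(C\sqcap D)^\mathcal{I}=\{(d,(m\times n)^\mathcal{I})\mid(d,m^\mathcal{I})\in C^\mathcal{I},(d,n^\mathcal{I})\in D^\mathcal{I}\}$, $(\exists R.C)^\mathcal{I}=\{(d,(m\times n)^\mathcal{I})\mid\exists e\,(d,e,m^\mathcal{I})\in R^\mathcal{I},(e,n^\mathcal{I})\in C^\mathcal{I}\}$. Satisfaction: $(R\sqsubseteq S,m)$ iff $(d,e,n^\mathcal{I})\in R^\mathcal{I}\Rightarrow(d,e,(m\times n)^\mathcal{I})\in S^\mathcal{I}$ for all $n$; $(G\sqsubseteq D,m)$ iff $(d,n^\mathcal{I})\in G^\mathcal{I}\Rightarrow(d,(m\times n)^\mathcal{I})\in D^\mathcal{I}$ for all $n$; $(A(a),m)$ iff $(a^\mathcal{I},m^\mathcal{I})\in A^\mathcal{I}$; $(R(a,b),m)$ iff $(a^\mathcal{I},b^\mathcal{I},m^\mathcal{I})\in R^\mathcal{I}$. $\mathcal{O}\models(\beta,m)$ iff all models of $\mathcal{O}$ satisfy it. -}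

module Defs where

open import Data.Nat using (ℕ)
open import Data.List using (List; []; _∷_; _++_; [_])
open import Data.List.Membership.Propositional using (_∈_)
open import Data.List.Relation.Unary.All using (All)
open import Data.List.Relation.Unary.Any using (Any)
open import Data.Maybe using (Maybe; just; nothing)
open import Data.Product using (Σ; ∃; _×_; _,_; proj₁)
open import Data.Unit using (⊤)
open import Relation.Binary.PropositionalEquality using (_≡_)
open import Function.Bundles using (_⇔_)

-- Names: four disjoint countably infinite sets, realised as four (type-level
-- distinct) copies of ℕ.
ConceptName : Set
ConceptName = ℕ
RoleName : Set
RoleName = ℕ
IndName : Set
IndName = ℕ
Var : Set
Var = ℕ

-- Monomials: finite products of variables, represented by lists of variables;
-- product is concatenation, 1 is the empty list, and (Trio semiring)
-- m ≈ n iff m and n contain the same variables.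
Monomial : Set
Monomial = List Var

1ₘ : Monomial
1ₘ = []

_×ₘ_ : Monomial → Monomial → Monomial
m ×ₘ n = m ++ n

_≈ₘ_ : Monomial → Monomial → Set
m ≈ₘ n = ∀ x → (x ∈ m) ⇔ (x ∈ n)

data Concept : Set where
  atom : ConceptName → Concept
  ⊤c   : Concept
  ex   : RoleName → Concept → Concept
  _⊓_  : Concept → Concept → Concept

data RHS : Set where
  atomʳ : ConceptName → RHS
  exʳ   : RoleName → RHS

data Axiom : Set where
  gci     : Concept → RHS → Axiom
  rinc    : RoleName → RoleName → Axiom
  ran     : RoleName → ConceptName → Axiom
  cassert : ConceptName → IndName → Axiom
  rassert : RoleName → IndName → IndName → Axiom

-- Annotations v ∈ N_V ∪ {1}: just x is the variable x, nothing is 1.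
Annotation : Set
Annotation = Maybe Var

annot : Annotation → Monomial
annot (just x) = [ x ]
annot nothing  = 1ₘ

AnnotatedOntology : Set
AnnotatedOntology = List (Axiom × Annotation)

data Basic : Concept → Set where
  basic-atom : ∀ A → Basic (atom A)
  basic-⊤    : Basic ⊤c

data NormalGCI : Concept → RHS → Set where
  nf-sub  : ∀ {C} B → Basic C → NormalGCI C (atomʳ B)
  nf-conj : ∀ {C C'} B → Basic C → Basic C' → NormalGCI (C ⊓ C') (atomʳ B)
  nf-ex   : ∀ {C} R → Basic C → NormalGCI C (exʳ R)
  nf-exl  : ∀ {C} R B → Basic C → NormalGCI (ex R C) (atomʳ B)

NormalAxiom : Axiom → Set
NormalAxiom (gci C D) = NormalGCI C D
NormalAxiom _         = ⊤

NormalForm : AnnotatedOntology → Set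
NormalForm O = All (λ p → NormalAxiom (proj₁ p)) O

data OccursIn (a : IndName) : Axiom → Set where
  occ-c  : ∀ A → OccursIn a (cassert A a)
  occ-rl : ∀ R b → OccursIn a (rassert R a b)
  occ-rr : ∀ R b → OccursIn a (rassert R b a)

Occurs : IndName → AnnotatedOntology → Set
Occurs a O = Any (λ p → OccursIn a (proj₁ p)) O

record Interpretation : Set₁ where
  field
    Δ    : Set
    Δm   : Set                                -- monomial domain (disjoint: separate type)
    ind  : IndName → Δ
    conc : ConceptName → Δ → Δm → Set
    role : RoleName → Δ → Δ → Δm → Set
    mon  : Monomial → Δm
    mon-faithful : ∀ m n → (mon m ≡ mon n) ⇔ (m ≈ₘ n)

module _ (I : Interpretation) where
  open Interpretation I

  ext : Concept → Δ → Δm → Set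
  ext (atom A) d μ = conc A d μ
  ext ⊤c d μ = μ ≡ mon 1ₘ
  ext (ex R C) d μ =
    Σ Δ λ e → Σ Monomial λ m → Σ Monomial λ n →
      role R d e (mon m) × ext C e (mon n) × (μ ≡ mon (m ×ₘ n))
  ext (C ⊓ D) d μ =
    Σ Monomial λ m → Σ Monomial λ n →
      ext C d (mon m) × ext D d (mon n) × (μ ≡ mon (m ×ₘ n))

  extʳ : RHS → Δ → Δm → Set
  extʳ (atomʳ A) d μ = conc A d μ
  extʳ (exʳ R) d μ = Σ Δ λ e → role R d e μ

  Sat : Axiom → Monomial → Set
  Sat (gci C D) m = ∀ d n → ext C d (mon n) → extʳ D d (mon (m ×ₘ n))
  Sat (rinc R S) m = ∀ d e n → role R d e (mon n) → role S d e (mon (m ×ₘ n))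
  Sat (ran R A) m = ∀ e n → (Σ Δ λ d → role R d e (mon n)) → conc A e (mon (m ×ₘ n))
  Sat (cassert A a) m = conc A (ind a) (mon m)
  Sat (rassert R a b) m = role R (ind a) (ind b) (mon m)

  Model : AnnotatedOntology → Set
  Model O = All (λ p → Sat (proj₁ p) (annot (Data.Product.proj₂ p))) O

_⊨_,_ : AnnotatedOntology → Axiom → Monomial → Set₁
O ⊨ β , m = (I : Interpretation) → Model I O → Sat I β m

-- For ⇒, instantiate the role inclusion at the pair (a₀, b₀).  For ⇐, let I
-- be a model of O with (d, e, n) ∈ S^I.  Extend I by a point `fresh` naming
-- both a₀ and b₀, with (fresh, fresh, k) ∈ P^I′ exactly when (d, e, k × n) ∈ P^I,
-- and a point `sink` witnessing every existential; both new points belong to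
-- every concept name with every monomial.  Since a₀ and b₀ do not occur in O,
-- I′ is still a model of O, and it satisfies (S(a₀, b₀), 1) because
-- (d, e, n) ∈ S^I.  Hence (fresh, fresh, m) ∈ R^I′, i.e. (d, e, m × n) ∈ R^I.
module Submission where

open import Defs
open import Data.List using (_++_; [_])
open import Data.List.Properties using (++-identityʳ; ++-assoc)
open import Data.List.Relation.Binary.BagAndSetEquality using (++-cong)
open import Data.List.Relation.Unary.All using (_∷_; []; zip; zipWith)
open import Data.List.Relation.Unary.All.Properties using (++⁺; ++⁻; ¬Any⇒All¬)
open import Data.Maybe using (nothing)
open import Data.Empty using (⊥; ⊥-elim)
open import Data.Nat using (_≟_)
open import Data.Product using (Σ; _×_; _,_)
open import Data.Sum using (_⊎_; inj₁; inj₂)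
open import Data.Unit using (⊤; tt)
open import Function.Bundles using (_⇔_; mk⇔; Equivalence)
open import Function.Construct.Identity using (⇔-id)
open import Relation.Nullary using (¬_; yes; no)
open import Relation.Nullary.Decidable using (_⊎-dec_)
open import Relation.Binary.PropositionalEquality using (_≡_; refl; sym; subst; subst₂; cong)

open Equivalence using (to; from)

≈ₘ-×ₘʳ : ∀ {k l} n → k ≈ₘ l → (k ×ₘ n) ≈ₘ (l ×ₘ n)
≈ₘ-×ₘʳ {k} {l} n k≈l x = ++-cong {xs₁ = k} {l} {n} {n} (λ {y} → k≈l y) (⇔-id _)

module _ (I : Interpretation) where
  open Interpretation I

  mon-×ₘʳ : ∀ {k l} n → mon k ≡ mon l → mon (k ×ₘ n) ≡ mon (l ×ₘ n)
  mon-×ₘʳ {k} {l} n eq =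
    from (mon-faithful (k ×ₘ n) (l ×ₘ n)) (≈ₘ-×ₘʳ n (to (mon-faithful k l) eq))

data Extended (Δ : Set) : Set where
  old   : Δ → Extended Δ
  fresh : Extended Δ
  sink  : Extended Δ

module Extension (I : Interpretation) (d e : Interpretation.Δ I) (n : Monomial)
                 (a₀ b₀ : IndName) where
  open Interpretation I

  IsFresh : IndName → Set
  IsFresh c = c ≡ a₀ ⊎ c ≡ b₀

  ind′ : IndName → Extended Δ
  ind′ c with (c ≟ a₀) ⊎-dec (c ≟ b₀)
  ... | yes _ = fresh
  ... | no _  = old (ind c)

  ind′-fresh : ∀ {c} → IsFresh c → ind′ c ≡ fresh
  ind′-fresh {c} c-fresh with (c ≟ a₀) ⊎-dec (c ≟ b₀)
  ... | yes _ = refl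
  ... | no ¬c-fresh = ⊥-elim (¬c-fresh c-fresh)

  ind′-old : ∀ {c} → ¬ IsFresh c → ind′ c ≡ old (ind c)
  ind′-old {c} ¬c-fresh with (c ≟ a₀) ⊎-dec (c ≟ b₀)
  ... | yes c-fresh = ⊥-elim (¬c-fresh c-fresh)
  ... | no _ = refl

  conc′ : ConceptName → Extended Δ → Δm → Set
  conc′ A (old x) μ = conc A x μ
  conc′ A _       μ = ⊤

  -- μ ranges over all of Δm, which need not consist of interpreted monomials.
  role′ : RoleName → Extended Δ → Extended Δ → Δm → Set
  role′ P (old x) (old y) μ = role P x y μ
  role′ P fresh   fresh   μ = Σ Monomial λ k → μ ≡ mon k × role P d e (mon (k ×ₘ n))
  role′ P fresh   sink    μ = ⊤
  role′ P sink    sink    μ = ⊤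
  role′ P _       _       μ = ⊥

  I′ : Interpretation
  I′ = record { Δ = Extended Δ ; Δm = Δm ; ind = ind′ ; conc = conc′ ; role = role′
              ; mon = mon ; mon-faithful = mon-faithful }

  role′-fresh : ∀ P k → role′ P fresh fresh (mon k) → role P d e (mon (k ×ₘ n))
  role′-fresh P k (l , k≡l , r) = subst (role P d e) (mon-×ₘʳ I n (sym k≡l)) r

  ext-old : ∀ C {x μ} → ext I′ C (old x) μ → ext I C x μ
  ext-old (atom A) c = c
  ext-old ⊤c       c = c
  ext-old (ex P C) (old y , k , l , r , c , eq) = y , k , l , r , ext-old C c , eq
  ext-old (C ⊓ D)  (k , l , c , c′ , eq) = k , l , ext-old C c , ext-old D c′ , eq

  occurring-not-fresh : ∀ {c α} → OccursIn c α →
                        ¬ OccursIn a₀ α → ¬ OccursIn b₀ α → ¬ IsFresh c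
  occurring-not-fresh occ ¬a₀ _ (inj₁ refl) = ¬a₀ occ
  occurring-not-fresh occ _ ¬b₀ (inj₂ refl) = ¬b₀ occ

  Sat-extend : ∀ α v → ¬ OccursIn a₀ α → ¬ OccursIn b₀ α → Sat I α v → Sat I′ α v
  Sat-extend (gci C (atomʳ B)) v _ _ s (old x) k c = s x k (ext-old C c)
  Sat-extend (gci C (atomʳ B)) v _ _ s fresh   k c = tt
  Sat-extend (gci C (atomʳ B)) v _ _ s sink    k c = tt
  Sat-extend (gci C (exʳ P))   v _ _ s (old x) k c with s x k (ext-old C c)
  ... | y , r = old y , r
  Sat-extend (gci C (exʳ P))   v _ _ s fresh   k c = sink , tt
  Sat-extend (gci C (exʳ P))   v _ _ s sink    k c = sink , tt
  Sat-extend (rinc P Q) v _ _ s (old x) (old y) k r = s x y k r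
  Sat-extend (rinc P Q) v _ _ s fresh   fresh   k r =
    v ×ₘ k , refl ,
    subst (role Q d e) (cong mon (sym (++-assoc v k n))) (s d e (k ×ₘ n) (role′-fresh P k r))
  Sat-extend (rinc P Q) v _ _ s fresh   sink    k r = tt
  Sat-extend (rinc P Q) v _ _ s sink    sink    k r = tt
  Sat-extend (ran P A) v _ _ s (old y) k (old x , r) = s y k (x , r)
  Sat-extend (ran P A) v _ _ s fresh   k _ = tt
  Sat-extend (ran P A) v _ _ s sink    k _ = tt
  Sat-extend (cassert A c) v ¬a₀ ¬b₀ s
    rewrite ind′-old (occurring-not-fresh (occ-c A) ¬a₀ ¬b₀) = s
  Sat-extend (rassert P c c′) v ¬a₀ ¬b₀ s
    rewrite ind′-old (occurring-not-fresh (occ-rl P c′) ¬a₀ ¬b₀)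
          | ind′-old (occurring-not-fresh (occ-rr P c) ¬a₀ ¬b₀) = s

  Model-extend : ∀ O → ¬ Occurs a₀ O → ¬ Occurs b₀ O → Model I O → Model I′ O
  Model-extend O ¬a₀ ¬b₀ model =
    zipWith (λ { {α , v} ((¬a₀α , ¬b₀α) , s) → Sat-extend α (annot v) ¬a₀α ¬b₀α s })
            (zip (¬Any⇒All¬ O ¬a₀ , ¬Any⇒All¬ O ¬b₀) , model)

module _ (O : AnnotatedOntology) (S R : RoleName) (m : Monomial) (a₀ b₀ : IndName) where

  O⁺ : AnnotatedOntology
  O⁺ = O ++ [ (rassert S a₀ b₀ , nothing) ]

  rinc⇒rassert : O ⊨ rinc S R , m → O⁺ ⊨ rassert R a₀ b₀ , m
  rinc⇒rassert O⊨S⊑R I model with ++⁻ O model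
  ... | model-O , S[a₀,b₀] ∷ [] =
    subst (λ k → role R (ind a₀) (ind b₀) (mon k)) (++-identityʳ m)
          (O⊨S⊑R I model-O (ind a₀) (ind b₀) 1ₘ S[a₀,b₀])
    where open Interpretation I

  rassert⇒rinc : ¬ Occurs a₀ O → ¬ Occurs b₀ O →
                 O⁺ ⊨ rassert R a₀ b₀ , m → O ⊨ rinc S R , m
  rassert⇒rinc ¬a₀ ¬b₀ O⁺⊨R[a₀,b₀] I model d e n S[d,e] =
    role′-fresh R m (subst₂ (λ x y → role′ R x y (mon m)) a₀↦fresh b₀↦fresh R[a₀,b₀])
    where
    open Interpretation I using (mon)
    open Extension I d e n a₀ b₀
    a₀↦fresh : ind′ a₀ ≡ fresh
    a₀↦fresh = ind′-fresh (inj₁ refl)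
    b₀↦fresh : ind′ b₀ ≡ fresh
    b₀↦fresh = ind′-fresh (inj₂ refl)
    S[a₀,b₀] : Sat I′ (rassert S a₀ b₀) 1ₘ
    S[a₀,b₀] rewrite a₀↦fresh | b₀↦fresh = 1ₘ , refl , S[d,e]
    R[a₀,b₀] : Sat I′ (rassert R a₀ b₀) m
    R[a₀,b₀] = O⁺⊨R[a₀,b₀] I′ (++⁺ (Model-extend O ¬a₀ ¬b₀ model) (S[a₀,b₀] ∷ []))

proposition4 : (O : AnnotatedOntology) → NormalForm O →
    (S R : RoleName) (m : Monomial) (a₀ b₀ : IndName) →
    ¬ Occurs a₀ O → ¬ Occurs b₀ O →
    (O ⊨ rinc S R , m) ⇔ ((O ++ [ (rassert S a₀ b₀ , nothing) ]) ⊨ rassert R a₀ b₀ , m)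
proposition4 O _ S R m a₀ b₀ ¬a₀ ¬b₀ =
  mk⇔ (rinc⇒rassert O S R m a₀ b₀) (rassert⇒rinc O S R m a₀ b₀ ¬a₀ ¬b₀)
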